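{- Let $Prop$ be a nonempty finite set of propositional variables. There is no binary connective $>$ such that, when the team semantics of the language $[\neg,\wedge,\vee,\nabla]$ is extended to the language $[\neg,\wedge,\vee,\nabla,>]$ (in which $>$ may be applied to arbitrary formulas, and the semantic clauses of $\neg,\wedge,\vee,\nabla$ remain as given for all formulas of the extended language), all of the following hold: (i) every formula of $[\neg,\wedge,\vee,\nabla,>]$ is union closed; (ii) Modus Ponens: $\varphi,\varphi>\psi\models\psi$ for all formulas $\varphi,\psi$ of the extended language; (iii) Deduction Theorem: for every set $\Gamma\cup\{\varphi,\psi\}$ of formulas of the extended language, if $\Gamma,\varphi\models\psi$ then $\Gamma\models\varphi>\psi$.
   Context: A valuation is a function $v:Prop\to\{0,1\}$; a team is a set of valuations. Formulas of $[\neg,\wedge,\vee,\nabla]$ are generated by $\varphi::=p\mid\neg\varphi\mid\varphi\wedge\varphi\mid\varphi\vee\varphi\mid\nabla\varphi$ with $p\in Prop$. Team semantics: $T\models p$ iff $v(p)=1$ for all $v\in T$; $T\models\neg\varphi$ iff $\{v\}\not\models\varphi$ for all $v\in T$; $T\models\varphi\wedge\psi$ iff $T\models\varphi$ and $T\models\psi$; $T\models\varphi\vee\psi$ iff there are $T_1,T_2$ with $T=T_1\cup T_2$, $T_1\models\varphi$, $T_2\models\psi$; $T\models\nabla\varphi$ iff $T=\emptyset$ or there is a nonempty $S\subseteq T$ with $S\models\varphi$. A formula is union closed if $T\models\varphi$ and $S\models\varphi$ imply $S\cup T\models\varphi$. $\Gamma\models\psi$ means every team satisfying all formulas of $\Gamma$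 satisfies $\psi$. -}

module Defs where

open import Data.Nat using (ℕ)
open import Data.Fin using (Fin)
open import Data.Bool using (Bool; true; false; _∨_)
open import Data.Vec using (Vec; lookup)
open import Data.Product using (Σ; _×_; ∃)
open import Data.Sum using (_⊎_)
open import Relation.Binary.PropositionalEquality using (_≡_)
open import Relation.Nullary using (¬_)

Valuation : ℕ → Set
Valuation n = Vec Bool n

-- A team is a set of valuations; since there are finitely many valuations,
-- we represent it by its (decidable) characteristic function.
Team : ℕ → Set
Team n = Valuation n → Bool

_∈T_ : {n : ℕ} → Valuation n → Team n → Set
v ∈T T = T v ≡ true

_∪T_ : {n : ℕ} → Team n → Team n → Team n
(T₁ ∪T T₂) v = T₁ v ∨ T₂ v

IsUnion : {n : ℕ} → Team n → Team n → Team n → Set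
IsUnion T T₁ T₂ = ∀ v → T v ≡ (T₁ v ∨ T₂ v)

_⊆T_ : {n : ℕ} → Team n → Team n → Set
S ⊆T T = ∀ v → v ∈T S → v ∈T T

EmptyT : {n : ℕ} → Team n → Set
EmptyT T = ∀ v → T v ≡ false

NonemptyT : {n : ℕ} → Team n → Set
NonemptyT T = ∃ λ v → v ∈T T

IsSingleton : {n : ℕ} → Valuation n → Team n → Set
IsSingleton v S = ∀ w → (w ∈T S → w ≡ v) × (w ≡ v → w ∈T S)

data Form (n : ℕ) : Set where
  var  : Fin n → Form n
  neg  : Form n → Form n
  _∧'_ : Form n → Form n → Form n
  _∨'_ : Form n → Form n → Form n
  ∇'   : Form n → Form n
  _▷_  : Form n → Form n → Form n

-- A binary connective is interpreted semantically as an operation on the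
-- meanings (properties of teams) of its two arguments.
Connective : ℕ → Set₁
Connective n = (Team n → Set) → (Team n → Set) → (Team n → Set)

sat : {n : ℕ} → Connective n → Team n → Form n → Set
sat C T (var p)   = ∀ v → v ∈T T → lookup v p ≡ true
sat C T (neg φ)   = ∀ v → v ∈T T → ∀ S → IsSingleton v S → ¬ sat C S φ
sat C T (φ ∧' ψ)  = sat C T φ × sat C T ψ
sat C T (φ ∨' ψ)  = Σ (Team _) λ T₁ → Σ (Team _) λ T₂ →
                      IsUnion T T₁ T₂ × sat C T₁ φ × sat C T₂ ψ
sat C T (∇' φ)    = EmptyT T ⊎ (Σ (Team _) λ S → S ⊆T T × NonemptyT S × sat C S φ)
sat C T (φ ▷ ψ)   = C (λ S → sat C S φ) (λ S → sat C S ψ) T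

Entails : {n : ℕ} → Connective n → (Form n → Set) → Form n → Set
Entails C Γ ψ = ∀ T → (∀ χ → Γ χ → sat C T χ) → sat C T ψ

_,,_ : {n : ℕ} → (Form n → Set) → Form n → (Form n → Set)
(Γ ,, φ) χ = Γ χ ⊎ χ ≡ φ

pair : {n : ℕ} → Form n → Form n → (Form n → Set)
pair φ ψ χ = χ ≡ φ ⊎ χ ≡ ψ

UnionClosed : {n : ℕ} → Connective n → Form n → Set
UnionClosed C φ = ∀ T S → sat C T φ → sat C S φ → sat C (T ∪T S) φ

AllUnionClosed : {n : ℕ} → Connective n → Set
AllUnionClosed C = ∀ φ → UnionClosed C φ

ModusPonens : {n : ℕ} → Connective n → Set
ModusPonens C = ∀ φ ψ → Entails C (pair φ (φ ▷ ψ)) ψ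

DeductionTheorem : {n : ℕ} → Connective n → Set₁
DeductionTheorem C = ∀ (Γ : Form _ → Set) φ ψ → Entails C (Γ ,, φ) ψ → Entails C Γ (φ ▷ ψ)

{-# OPTIONS --safe #-}
-- Both p and ¬p entail ∇p ▷ p by the deduction theorem: p, ∇p ⊨ p trivially, and
-- ¬p, ∇p ⊨ p because ¬p ∧ ∇p only holds in the empty team (p is flat, so a nonempty
-- subteam satisfying p yields a singleton satisfying p).  By union closure ∇p ▷ p then
-- holds in the team of all valuations, which also satisfies ∇p; modus ponens gives p
-- there, although that team contains a valuation falsifying p.
module Submission where

open import Defs
open import Data.Nat using (ℕ; suc)
open import Data.Product using (_×_; _,_; proj₁; proj₂)
open import Relation.Nullary using (¬_; yes; no)
open import Data.Fin using (Fin; zero)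
open import Data.Bool using (true; false; not)
open import Data.Bool.Properties using (∨-inverseʳ; not-¬) renaming (_≟_ to _≟B_)
open import Data.Vec using (lookup; replicate)
open import Data.Vec.Properties using (≡-dec; lookup-replicate)
open import Data.Sum using (inj₁; inj₂)
open import Data.Empty using (⊥-elim)
open import Relation.Binary.PropositionalEquality using (_≡_; refl; sym; trans; subst)

singletonT : {n : ℕ} → Valuation n → Team n
singletonT u v with ≡-dec _≟B_ v u
... | yes _ = true
... | no _  = false

singletonT-isSingleton : {n : ℕ} (u : Valuation n) → IsSingleton u (singletonT u)
singletonT-isSingleton u w with ≡-dec _≟B_ w u
... | yes w≡u = (λ _ → w≡u) , (λ _ → refl)
... | no w≢u  = (λ ()) , (λ w≡u → ⊥-elim (w≢u w≡u))

truthT falsityT : {n : ℕ} → Fin n → Team n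
truthT p v = lookup v p
falsityT p v = not (lookup v p)

truthT∪falsityT-complete : {n : ℕ} (p : Fin n) (v : Valuation n) → v ∈T (truthT p ∪T falsityT p)
truthT∪falsityT-complete p v = ∨-inverseʳ (lookup v p)

module UnderConnective (n : ℕ) (C : Connective n) where

  var-downwardClosed : ∀ {S T} (p : Fin n) → S ⊆T T → sat C T (var p) → sat C S (var p)
  var-downwardClosed p S⊆T Tp v v∈S = Tp v (S⊆T v v∈S)

  neg∧∇-var⇒empty : ∀ {T} (p : Fin n) → sat C T (neg (var p)) → sat C T (∇' (var p)) → EmptyT T
  neg∧∇-var⇒empty p T¬p (inj₁ T-empty) = T-empty
  neg∧∇-var⇒empty p T¬p (inj₂ (S , S⊆T , (u , u∈S) , Sp)) =
    ⊥-elim (T¬p u (S⊆T u u∈S) (singletonT u) (singletonT-isSingleton u)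
      (var-downwardClosed p u⊆S Sp))
    where
    u⊆S : singletonT u ⊆T S
    u⊆S w w∈u = subst (_∈T S) (sym (proj₁ (singletonT-isSingleton u w) w∈u)) u∈S

  sat-empty-var : ∀ {T} (p : Fin n) → EmptyT T → sat C T (var p)
  sat-empty-var p T-empty v v∈T with trans (sym v∈T) (T-empty v)
  ... | ()

  truthT-sat-var : (p : Fin n) → sat C (truthT p) (var p)
  truthT-sat-var p v v∈T = v∈T

  falsityT-sat-neg-var : (p : Fin n) → sat C (falsityT p) (neg (var p))
  falsityT-sat-neg-var p v v∈T S S-singleton Sp =
    not-¬ (sym (Sp v (proj₂ (S-singleton v) refl))) (sym v∈T)

  truthT∪falsityT-sat-∇-var : (p : Fin n) → sat C (truthT p ∪T falsityT p) (∇' (var p))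
  truthT∪falsityT-sat-∇-var p =
    inj₂ (truthT p , (λ v _ → truthT∪falsityT-complete p v) ,
          (replicate n true , lookup-replicate p true) , truthT-sat-var p)

  truthT∪falsityT-¬sat-var : (p : Fin n) → ¬ sat C (truthT p ∪T falsityT p) (var p)
  truthT∪falsityT-¬sat-var p Tp
    with trans (sym (lookup-replicate p false))
               (Tp (replicate n false) (truthT∪falsityT-complete p (replicate n false)))
  ... | ()

  deduce-from-one : DeductionTheorem C → ∀ χ φ ψ →
    (∀ T → sat C T χ → sat C T φ → sat C T ψ) → ∀ T → sat C T χ → sat C T (φ ▷ ψ)
  deduce-from-one dt χ φ ψ χ,φ⊨ψ T Tχ =
    dt (_≡ χ) φ ψ
      (λ S S⊨ → χ,φ⊨ψ S (S⊨ χ (inj₁ refl)) (S⊨ φ (inj₂ refl)))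
      T (λ { _ refl → Tχ })

  detach : ModusPonens C → ∀ {T} φ ψ → sat C T φ → sat C T (φ ▷ ψ) → sat C T ψ
  detach mp {T} φ ψ Tφ Tφ▷ψ =
    mp φ ψ T (λ { _ (inj₁ refl) → Tφ ; _ (inj₂ refl) → Tφ▷ψ })

theorem1 : (m : ℕ) (C : Connective (suc m)) → ¬ (AllUnionClosed C × ModusPonens C × DeductionTheorem C)
theorem1 m C (uc , mp , dt) =
  truthT∪falsityT-¬sat-var x
    (detach mp ∇p p (truthT∪falsityT-sat-∇-var x)
      (uc (∇p ▷ p) (truthT x) (falsityT x) p⊨∇p▷p ¬p⊨∇p▷p))
  where
  open UnderConnective (suc m) C

  x : Fin (suc m)
  x = zero

  p ∇p : Form (suc m)
  p = var x
  ∇p = ∇' p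

  p⊨∇p▷p : sat C (truthT x) (∇p ▷ p)
  p⊨∇p▷p = deduce-from-one dt p ∇p p (λ _ Tp _ → Tp) (truthT x) (truthT-sat-var x)

  ¬p⊨∇p▷p : sat C (falsityT x) (∇p ▷ p)
  ¬p⊨∇p▷p = deduce-from-one dt (neg p) ∇p p
    (λ T T¬p T∇p → sat-empty-var x (neg∧∇-var⇒empty x T¬p T∇p))
    (falsityT x) (falsityT-sat-neg-var x)
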